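{- In the non-preemptive sUETS problem, the online algorithm that, whenever a machine is available and an unprocessed job remains, assigns a batch consisting of a single unprocessed job to that machine, is $O(n/m)$-competitive; that is, there is an absolute constant $C$ such that its makespan is at most $C\cdot(n/m)$ times the optimal makespan on every instance.
   Context: Non-preemptive sUETS: a finite set $J$ of $n$ jobs and $m$ identical machines, $n\ge m\ge 2$, all jobs available at time $0$. A known setup-time function $c:2^J\to\mathbb{R}_{\ge0}$ is monotone ($c(X)\le c(Y)$ for $X\subseteq Y$) and subadditive ($c(X)+c(Y)\ge c(X\cup Y)$ for disjoint $X,Y$). Each job $j$ has execution time $p_j\ge0$, unknown to an online algorithm until $j$ completes; $p(X)=\sum_{j\in X}p_j$. An algorithm repeatedly forms batches (sets of jobs not completed and not assigned elsewhere) and assigns each batch to a single idle machine, which processes batch $X$ without interruption in time $c(X)+p(X)$. The makespan is the completion time of all jobs. The optimal makespan is $\min_{(X_1,\dots,X_m)\text{ partition of }J}\max_{i}(c(X_i)+p(X_i))$. An algorithm is $\rho$-competitive if its makespan is at most $\rho$ times the optimal makespan on every instance.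
   Formalization: The setup-time function $c$ and the execution times $p_j$ take nonnegative rational values rather than values in ℝ≥0. -}

module Defs where

open import Data.Nat as ℕ using (ℕ; zero; suc)
open import Data.Integer using (+_)
open import Data.Rational using (ℚ; 0ℚ; _+_; _≤_; _⊔_; _/_)
open import Data.Bool using (Bool; true; false; if_then_else_)
open import Data.Fin using (Fin; _≟_)
open import Data.Fin.Subset using (Subset; _⊆_; _∪_; _∩_; Empty; ⁅_⁆)
open import Data.List using (List; []; _∷_; foldr; map; allFin)
open import Data.Vec using (lookup; tabulate)
open import Relation.Nullary.Decidable using (⌊_⌋)

-- Maximum of a finite family of (nonnegative) rationals; the base value 0
-- is harmless since all quantities maximised below are nonnegative.
maxOf : ∀ {m} → (Fin m → ℚ) → ℚ
maxOf {m} L = foldr _⊔_ 0ℚ (map L (allFin m))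

psum : ∀ {n} → (Fin n → ℚ) → Subset n → ℚ
psum {n} p X = foldr _+_ 0ℚ (map (λ j → if lookup X j then p j else 0ℚ) (allFin n))

Monotone : ∀ {n} → (Subset n → ℚ) → Set
Monotone c = ∀ X Y → X ⊆ Y → c X ≤ c Y

Subadditive : ∀ {n} → (Subset n → ℚ) → Set
Subadditive c = ∀ X Y → Empty (X ∩ Y) → c (X ∪ Y) ≤ c X + c Y

part : ∀ {n m} → (Fin n → Fin m) → Fin m → Subset n
part f i = tabulate (λ j → ⌊ f j ≟ i ⌋)

-- max_i (c(X_i) + p(X_i)) : makespan of the offline schedule given by f
partitionMakespan : ∀ {n m} → (Subset n → ℚ) → (Fin n → ℚ) → (Fin n → Fin m) → ℚ
partitionMakespan c p f = maxOf (λ i → c (part f i) + psum p (part f i))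

addLoad : ∀ {m} → (Fin m → ℚ) → Fin m → ℚ → (Fin m → ℚ)
addLoad L i w k = if ⌊ k ≟ i ⌋ then L k + w else L k

-- Singleton-batch greedy: the jobs are started in the order given by the list;
-- each next job (as singleton batch {j}, taking time c({j}) + p_j) goes to a
-- machine that becomes idle earliest (i.e. currently has minimal load;
-- ties broken arbitrarily).
data GreedyRun {n m : ℕ} (c : Subset n → ℚ) (p : Fin n → ℚ)
     : List (Fin n) → (Fin m → ℚ) → (Fin m → ℚ) → Set where
  done : ∀ L → GreedyRun c p [] L L
  step : ∀ j js L L' (i : Fin m) → (∀ k → L i ≤ L k) →
         GreedyRun c p js (addLoad L i (c ⁅ j ⁆ + p j)) L' →
         GreedyRun c p (j ∷ js) L L'

-- n / m as a rational (the m = 0 branch is never used, since m ≥ 2)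
ratio : ℕ → ℕ → ℚ
ratio n zero = 0ℚ
ratio n (suc k) = (+ n) / suc k

{-# OPTIONS --safe #-}
module Submission where

-- A singleton batch {j} fits inside the part X_(f j) of any partition f, so by
-- monotonicity of c and nonnegativity of p its time c{j} + p_j is at most the
-- makespan M of that partition.  Greedy singleton scheduling is then Graham's
-- list scheduling: each job goes to a least loaded machine, whose load is at
-- most the average, so every final load is at most
-- (total time)/m + M ≤ (n/m) M + M ≤ 2 (n/m) M, as m ≤ n.

open import Defs
open import Algebra.Bundles using (Ring; CommutativeMonoid)
open import Data.Bool using (true; false; if_then_else_)
open import Data.Fin as Fin using (Fin; _≟_)
open import Data.Fin.Properties using (punchInᵢ≢i)
open import Data.Fin.Subset using (Subset; _⊆_; ⁅_⁆)
open import Data.Fin.Subset.Properties using (x∈⁅y⁆⇒x≡y)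
open import Data.Integer as ℤ using (+_)
import Data.Integer.Properties as ℤ
import Data.Integer.Solver as ℤ
open import Data.List using (List; _∷_; allFin; foldr; map; length)
open import Data.List.Membership.Propositional using (_∈_)
open import Data.List.Membership.Propositional.Properties using (∈-allFin; ∈-map⁺)
open import Data.List.Properties using (foldr-preservesʳ; foldr-preservesᵇ; length-tabulate)
open import Data.List.Relation.Binary.Permutation.Propositional using (_↭_)
open import Data.List.Relation.Binary.Permutation.Propositional.Properties using (↭-length)
open import Data.List.Relation.Unary.All as All using (All; _∷_)
open import Data.List.Relation.Unary.All.Properties using (map⁺)
open import Data.List.Relation.Unary.Any using (here; there)
open import Data.Nat as ℕ using (ℕ; zero; suc)
open import Data.Product using (∃; _,_)
open import Data.Rational using (ℚ; 0ℚ; 1ℚ; _≤_; _*_; _/_; _+_; _⊔_; toℚᵘ)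
open import Data.Rational.Properties hiding (_≟_)
import Data.Rational.Solver as ℚ
import Data.Rational.Unnormalised as ℚᵘ
import Data.Rational.Unnormalised.Properties as ℚᵘ
open import Data.Vec using (lookup)
open import Data.Vec.Functional using (removeAt)
open import Data.Vec.Properties using (lookup⇒[]=; lookup∘tabulate)
open import Relation.Binary.PropositionalEquality
open import Relation.Nullary using (Dec; yes; no; contradiction)
open import Relation.Nullary.Decidable using (⌊_⌋)

open import Algebra.Properties.Semiring.Mult (Ring.semiring +-*-ring)
  using (_×_; ×-assoc-*; ×-idem)
open import Algebra.Properties.CommutativeMonoid.Mult +-0-commutativeMonoid
  using (×-distrib-+)
open import Algebra.Properties.CommutativeMonoid.Sum +-0-commutativeMonoid
  using (sum; sum-replicate; sum-replicate-zero; sum-remove; sum-cong-≗)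
open import Algebra.Properties.CommutativeSemigroup
  (CommutativeMonoid.commutativeSemigroup +-0-commutativeMonoid)
  using (xy∙z≈xz∙y)

-- _/_ normalises by a gcd, so identities about it are proved in ℚᵘ via toℚᵘ.
/1-suc : ∀ k → (+ suc k) / 1 ≡ 1ℚ + (+ k) / 1
/1-suc k = toℚᵘ-injective (begin
  toℚᵘ ((+ suc k) / 1)           ≈⟨ toℚᵘ-fromℚᵘ (ℚᵘ.mkℚᵘ (+ suc k) 0) ⟩
  ℚᵘ.mkℚᵘ (+ suc k) 0            ≈⟨ ℚᵘ.*≡* (cong (λ i → (+ 1 ℤ.+ i) ℤ.* + 1) (sym (ℤ.*-identityʳ (+ k)))) ⟩
  ℚᵘ.1ℚᵘ ℚᵘ.+ ℚᵘ.mkℚᵘ (+ k) 0    ≈⟨ ℚᵘ.+-congʳ ℚᵘ.1ℚᵘ (toℚᵘ-fromℚᵘ (ℚᵘ.mkℚᵘ (+ k) 0)) ⟨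
  toℚᵘ 1ℚ ℚᵘ.+ toℚᵘ ((+ k) / 1) ≈⟨ toℚᵘ-homo-+ 1ℚ ((+ k) / 1) ⟨
  toℚᵘ (1ℚ + (+ k) / 1)        ∎)
  where open ℚᵘ.≃-Reasoning

/1*/-cancel : ∀ n k → ((+ suc k) / 1) * ((+ n) / suc k) ≡ (+ n) / 1
/1*/-cancel n k = toℚᵘ-injective (begin
  toℚᵘ (d * r)                              ≈⟨ toℚᵘ-homo-* d r ⟩
  toℚᵘ d ℚᵘ.* toℚᵘ r                        ≈⟨ ℚᵘ.*-cong (toℚᵘ-fromℚᵘ (ℚᵘ.mkℚᵘ (+ suc k) 0))
                                                          (toℚᵘ-fromℚᵘ (ℚᵘ.mkℚᵘ (+ n) k)) ⟩
  ℚᵘ.mkℚᵘ (+ suc k) 0 ℚᵘ.* ℚᵘ.mkℚᵘ (+ n) k  ≈⟨ ℚᵘ.*≡* (solve 2 (λ d n → (d :* n) :* con (+ 1) := n :* (con (+ 1) :* d))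
                                                                 refl (+ suc k) (+ n)) ⟩
  ℚᵘ.mkℚᵘ (+ n) 0                           ≈⟨ toℚᵘ-fromℚᵘ (ℚᵘ.mkℚᵘ (+ n) 0) ⟨
  toℚᵘ ((+ n) / 1)                          ∎)
  where
  open ℚᵘ.≃-Reasoning
  open ℤ.+-*-Solver
  d = (+ suc k) / 1
  r = (+ n) / suc k

×1ℚ≡/1 : ∀ k → k × 1ℚ ≡ (+ k) / 1
×1ℚ≡/1 zero    = refl
×1ℚ≡/1 (suc k) = trans (cong (λ q → 1ℚ + q) (×1ℚ≡/1 k)) (sym (/1-suc k))

×≡/1* : ∀ k x → k × x ≡ ((+ k) / 1) * x
×≡/1* k x = begin
  k × x           ≡⟨ cong (k ×_) (*-identityˡ x) ⟨
  k × (1ℚ * x)    ≡⟨ ×-assoc-* k 1ℚ x ⟨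
  (k × 1ℚ) * x    ≡⟨ cong (_* x) (×1ℚ≡/1 k) ⟩
  ((+ k) / 1) * x ∎
  where open ≡-Reasoning

p≤p+q : ∀ p {q} → 0ℚ ≤ q → p ≤ p + q
p≤p+q p 0≤q = ≤-trans (≤-reflexive (sym (+-identityʳ p))) (+-monoʳ-≤ p 0≤q)

×-nonNeg : ∀ k {x} → 0ℚ ≤ x → 0ℚ ≤ k × x
×-nonNeg zero    0≤x = ≤-refl
×-nonNeg (suc k) 0≤x = +-mono-≤ 0≤x (×-nonNeg k 0≤x)

×-monoʳ-≤ : ∀ k {x y} → x ≤ y → k × x ≤ k × y
×-monoʳ-≤ zero    x≤y = ≤-refl
×-monoʳ-≤ (suc k) x≤y = +-mono-≤ x≤y (×-monoʳ-≤ k x≤y)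

×-monoˡ-≤ : ∀ {j k x} → 0ℚ ≤ x → j ℕ.≤ k → j × x ≤ k × x
×-monoˡ-≤ {k = k} 0≤x ℕ.z≤n         = ×-nonNeg k 0≤x
×-monoˡ-≤ {x = x} 0≤x (ℕ.s≤s j≤k) = +-monoʳ-≤ x (×-monoˡ-≤ 0≤x j≤k)

×≤×⇒≤ratio* : ∀ n k {x y} → suc k × x ≤ n × y → x ≤ ratio n (suc k) * y
×≤×⇒≤ratio* n k {x} {y} le = *-cancelˡ-≤-pos d {{normalize-pos (suc k) 1}} (begin
  d * x           ≡⟨ ×≡/1* (suc k) x ⟨
  suc k × x       ≤⟨ le ⟩
  n × y           ≡⟨ ×≡/1* n y ⟩
  ((+ n) / 1) * y ≡⟨ cong (_* y) (/1*/-cancel n k) ⟨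
  (d * r) * y     ≡⟨ *-assoc d r y ⟩
  d * (r * y)     ∎)
  where
  open ≤-Reasoning
  d = (+ suc k) / 1
  r = ratio n (suc k)

×≤×+×⇒≤2ratio* : ∀ {n k x M} → 0ℚ ≤ M → suc k ℕ.≤ n → suc k × x ≤ n × M + suc k × M →
                 x ≤ ((+ 2) / 1) * ratio n (suc k) * M
×≤×+×⇒≤2ratio* {n} {k} {x} {M} 0≤M m≤n le = begin
  x                                 ≤⟨ ×≤×⇒≤ratio* n k (begin
    suc k × x                           ≤⟨ le ⟩
    n × M + suc k × M                   ≤⟨ +-monoʳ-≤ (n × M) (×-monoˡ-≤ 0≤M m≤n) ⟩
    n × M + n × M                       ≡⟨ ×-distrib-+ M M n ⟨
    n × (M + M)                         ∎) ⟩
  ratio n (suc k) * (M + M)         ≡⟨ solve 2 (λ r M → r :* (M :+ M) := con ((+ 2) / 1) :* r :* M)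
                                               refl (ratio n (suc k)) M ⟩
  ((+ 2) / 1) * ratio n (suc k) * M ∎
  where
  open ≤-Reasoning
  open ℚ.+-*-Solver

sum-mono-≤ : ∀ {m} {L L′ : Fin m → ℚ} → (∀ i → L i ≤ L′ i) → sum L ≤ sum L′
sum-mono-≤ {zero}  le = ≤-refl
sum-mono-≤ {suc m} le = +-mono-≤ (le Fin.zero) (sum-mono-≤ (λ i → le (Fin.suc i)))

×≤sum : ∀ {m x} {L : Fin m → ℚ} → (∀ i → x ≤ L i) → m × x ≤ sum L
×≤sum {m} {x} {L} x≤L = begin
  m × x             ≡⟨ sum-replicate m ⟨
  sum {m} (λ _ → x) ≤⟨ sum-mono-≤ x≤L ⟩
  sum L             ∎
  where open ≤-Reasoning

module _ {m : ℕ} (L : Fin m → ℚ) (i : Fin m) (w : ℚ) where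

  addLoad-≡ : addLoad L i w i ≡ L i + w
  addLoad-≡ with i ≟ i
  ... | yes _  = refl
  ... | no i≢i = contradiction refl i≢i

  addLoad-≢ : ∀ {k} → k ≢ i → addLoad L i w k ≡ L k
  addLoad-≢ {k} k≢i with k ≟ i
  ... | yes k≡i = contradiction k≡i k≢i
  ... | no _    = refl

sum-addLoad : ∀ {m} (L : Fin m → ℚ) i w → sum (addLoad L i w) ≡ sum L + w
sum-addLoad {suc m} L i w = begin
  sum (addLoad L i w)                                 ≡⟨ sum-remove {i = i} (addLoad L i w) ⟩
  addLoad L i w i + sum (removeAt (addLoad L i w) i)  ≡⟨ cong₂ _+_ (addLoad-≡ L i w) (sum-cong-≗ unchanged) ⟩
  (L i + w) + sum (removeAt L i)                      ≡⟨ xy∙z≈xz∙y (L i) w _ ⟩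
  (L i + sum (removeAt L i)) + w                      ≡⟨ cong (_+ w) (sum-remove {i = i} L) ⟨
  sum L + w                                           ∎
  where
  open ≡-Reasoning
  unchanged : ∀ k → removeAt (addLoad L i w) i k ≡ removeAt L i k
  unchanged k = addLoad-≢ L i w (punchInᵢ≢i i k)

-- Graham's invariant: every load exceeds the average load by at most M
-- (multiplied through by m).
NearAverage : ∀ {m} → ℚ → (Fin m → ℚ) → Set
NearAverage {m} M L = ∀ k → m × L k ≤ sum L + m × M

nearAverage-0 : ∀ {m M} → 0ℚ ≤ M → NearAverage {m} M (λ _ → 0ℚ)
nearAverage-0 {m} {M} 0≤M k = begin
  m × 0ℚ                     ≡⟨ sum-replicate m ⟨
  sum {m} (λ _ → 0ℚ)         ≤⟨ p≤p+q _ (×-nonNeg m 0≤M) ⟩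
  sum {m} (λ _ → 0ℚ) + m × M ∎
  where open ≤-Reasoning

addLoad-nearAverage : ∀ {m M w} {L : Fin m → ℚ} {i} → (∀ k → L i ≤ L k) → 0ℚ ≤ w → w ≤ M →
                      NearAverage M L → NearAverage M (addLoad L i w)
addLoad-nearAverage {m} {M} {w} {L} {i} i-least 0≤w w≤M near k =
  ≤-trans (bound k (k ≟ i)) sum-grows
  where
  open ≤-Reasoning

  sum-grows : sum L + m × M ≤ sum (addLoad L i w) + m × M
  sum-grows = +-monoˡ-≤ (m × M) (≤-trans (p≤p+q (sum L) 0≤w) (≤-reflexive (sym (sum-addLoad L i w))))

  bound : ∀ k → Dec (k ≡ i) → m × addLoad L i w k ≤ sum L + m × M
  bound .i (yes refl) = begin
    m × addLoad L i w i ≡⟨ cong (m ×_) (addLoad-≡ L i w) ⟩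
    m × (L i + w)       ≡⟨ ×-distrib-+ (L i) w m ⟩
    m × L i + m × w     ≤⟨ +-mono-≤ (×≤sum i-least) (×-monoʳ-≤ m w≤M) ⟩
    sum L + m × M       ∎
  bound k (no k≢i) = begin
    m × addLoad L i w k ≡⟨ cong (m ×_) (addLoad-≢ L i w k≢i) ⟩
    m × L k             ≤⟨ near k ⟩
    sum L + m × M       ∎

module _ {n m : ℕ} {c : Subset n → ℚ} {p : Fin n → ℚ} {M : ℚ}
         (time≤M : ∀ j → c ⁅ j ⁆ + p j ≤ M) where

  greedyRun-sum : ∀ {js} {L₀ L : Fin m → ℚ} → GreedyRun c p js L₀ L → sum L ≤ sum L₀ + length js × M
  greedyRun-sum (done L) = ≤-reflexive (sym (+-identityʳ (sum L)))
  greedyRun-sum (step j js L₀ L i _ run) = begin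
    sum L                                ≤⟨ greedyRun-sum run ⟩
    sum (addLoad L₀ i w) + length js × M ≡⟨ cong (_+ length js × M) (sum-addLoad L₀ i w) ⟩
    (sum L₀ + w) + length js × M         ≤⟨ +-monoˡ-≤ (length js × M) (+-monoʳ-≤ (sum L₀) (time≤M j)) ⟩
    (sum L₀ + M) + length js × M         ≡⟨ +-assoc (sum L₀) M (length js × M) ⟩
    sum L₀ + suc (length js) × M         ∎
    where
    open ≤-Reasoning
    w = c ⁅ j ⁆ + p j

  greedyRun-nearAverage : (∀ j → 0ℚ ≤ c ⁅ j ⁆ + p j) →
                          ∀ {js} {L₀ L : Fin m → ℚ} → GreedyRun c p js L₀ L →
                          NearAverage M L₀ → NearAverage M L
  greedyRun-nearAverage 0≤time (done _) near = near
  greedyRun-nearAverage 0≤time (step j _ _ _ _ i-least run) near =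
    greedyRun-nearAverage 0≤time run (addLoad-nearAverage i-least (0≤time j) (time≤M j) near)

≤-foldr-⊔ : ∀ {x xs} → x ∈ xs → x ≤ foldr _⊔_ 0ℚ xs
≤-foldr-⊔ {xs = y ∷ _} (here refl)  = p≤p⊔q y _
≤-foldr-⊔ {xs = y ∷ _} (there x∈ys) = ≤-trans (≤-foldr-⊔ x∈ys) (p≤q⊔p y _)

≤-foldr-+ : ∀ {x xs} → All (0ℚ ≤_) xs → x ∈ xs → x ≤ foldr _+_ 0ℚ xs
≤-foldr-+ (_ ∷ 0≤ys) (here refl) = p≤p+q _ (foldr-preservesᵇ {P = 0ℚ ≤_} {f = _+_} +-mono-≤ ≤-refl 0≤ys)
≤-foldr-+ {x} {y ∷ ys} (0≤y ∷ 0≤ys) (there x∈ys) = begin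
  x                   ≤⟨ ≤-foldr-+ 0≤ys x∈ys ⟩
  foldr _+_ 0ℚ ys     ≤⟨ p≤p+q _ 0≤y ⟩
  foldr _+_ 0ℚ ys + y ≡⟨ +-comm _ y ⟩
  y + foldr _+_ 0ℚ ys ∎
  where open ≤-Reasoning

maxOf-upperBound : ∀ {m} (L : Fin m → ℚ) i → L i ≤ maxOf L
maxOf-upperBound L i = ≤-foldr-⊔ (∈-map⁺ L (∈-allFin i))

maxOf-nonNeg : ∀ {m} (L : Fin m → ℚ) → 0ℚ ≤ maxOf L
maxOf-nonNeg {m} L =
  foldr-preservesʳ {P = 0ℚ ≤_} {f = _⊔_} (λ x 0≤y → ≤-trans 0≤y (p≤q⊔p x _)) ≤-refl (map L (allFin m))

maxOf-lub : ∀ {m} {L : Fin m → ℚ} {B} → 0ℚ ≤ B → (∀ i → L i ≤ B) → maxOf L ≤ B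
maxOf-lub {m} {B = B} 0≤B L≤B =
  foldr-preservesᵇ {P = _≤ B} {f = _⊔_} ⊔-lub 0≤B (map⁺ (All.universal L≤B (allFin m)))

≤-psum : ∀ {n} {p : Fin n → ℚ} {X} → (∀ j → 0ℚ ≤ p j) → ∀ {j} → lookup X j ≡ true → p j ≤ psum p X
≤-psum {n} {p} {X} 0≤p {j} j∈X =
  subst (λ b → (if b then p j else 0ℚ) ≤ psum p X) j∈X
        (≤-foldr-+ (map⁺ (All.universal 0≤term (allFin n))) (∈-map⁺ term (∈-allFin j)))
  where
  term : Fin n → ℚ
  term i = if lookup X i then p i else 0ℚ

  0≤term : ∀ i → 0ℚ ≤ term i
  0≤term i with lookup X i
  ... | true  = 0≤p i
  ... | false = ≤-refl

∈-part : ∀ {n m} (f : Fin n → Fin m) j → lookup (part f (f j)) j ≡ true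
∈-part f j rewrite lookup∘tabulate (λ k → ⌊ f k ≟ f j ⌋) j with f j ≟ f j
... | yes _    = refl
... | no fj≢fj = contradiction refl fj≢fj

⁅⁆⊆part : ∀ {n m} (f : Fin n → Fin m) j → ⁅ j ⁆ ⊆ part f (f j)
⁅⁆⊆part f j x∈⁅j⁆ rewrite x∈⁅y⁆⇒x≡y j x∈⁅j⁆ = lookup⇒[]= j (part f (f j)) (∈-part f j)

singleton≤partitionMakespan : ∀ {n m} {c : Subset n → ℚ} {p : Fin n → ℚ} →
                              Monotone c → (∀ j → 0ℚ ≤ p j) → (f : Fin n → Fin m) →
                              ∀ j → c ⁅ j ⁆ + p j ≤ partitionMakespan c p f
singleton≤partitionMakespan {c = c} {p} mono 0≤p f j = begin
  c ⁅ j ⁆ + p j ≤⟨ +-mono-≤ (mono _ _ (⁅⁆⊆part f j)) (≤-psum {X = X} 0≤p (∈-part f j)) ⟩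
  c X + psum p X ≤⟨ maxOf-upperBound (λ i → c (part f i) + psum p (part f i)) (f j) ⟩
  partitionMakespan c p f ∎
  where
  open ≤-Reasoning
  X = part f (f j)

greedyRun-makespan : ∀ {n k} {c : Subset n → ℚ} {p : Fin n → ℚ} {order} {L : Fin (suc k) → ℚ} →
                     (∀ X → 0ℚ ≤ c X) → Monotone c → (∀ j → 0ℚ ≤ p j) → suc k ℕ.≤ n →
                     order ↭ allFin n → GreedyRun c p order (λ _ → 0ℚ) L →
                     (f : Fin n → Fin (suc k)) →
                     maxOf L ≤ ((+ 2) / 1) * ratio n (suc k) * partitionMakespan c p f
greedyRun-makespan {n} {k} {c} {p} {order} {L} 0≤c mono 0≤p m≤n order↭J run f =
  maxOf-lub {L = L} (×≤×+×⇒≤2ratio* 0≤M m≤n idle) (λ i → ×≤×+×⇒≤2ratio* 0≤M m≤n (busy i))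
  where
  m = suc k
  M = partitionMakespan c p f

  0≤M : 0ℚ ≤ M
  0≤M = maxOf-nonNeg (λ i → c (part f i) + psum p (part f i))

  time≤M : ∀ j → c ⁅ j ⁆ + p j ≤ M
  time≤M = singleton≤partitionMakespan mono 0≤p f

  length-order : length order ≡ n
  length-order = trans (↭-length order↭J) (length-tabulate (λ j → j))

  total : sum L ≤ n × M
  total = begin
    sum L                                 ≤⟨ greedyRun-sum time≤M run ⟩
    sum {m} (λ _ → 0ℚ) + length order × M ≡⟨ cong₂ _+_ (sum-replicate-zero m) (cong (_× M) length-order) ⟩
    0ℚ + n × M                            ≡⟨ +-identityˡ (n × M) ⟩
    n × M                                 ∎
    where open ≤-Reasoning

  busy : ∀ i → m × L i ≤ n × M + m × M
  busy i = ≤-trans (greedyRun-nearAverage time≤M 0≤time run (nearAverage-0 0≤M) i) (+-monoˡ-≤ (m × M) total)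
    where
    0≤time : ∀ j → 0ℚ ≤ c ⁅ j ⁆ + p j
    0≤time j = +-mono-≤ (0≤c ⁅ j ⁆) (0≤p j)

  -- maxOf folds from 0ℚ, so the bound must dominate 0 as well.
  idle : m × 0ℚ ≤ n × M + m × M
  idle = ≤-trans (≤-reflexive (×-idem (+-identityˡ 0ℚ) m)) (+-mono-≤ (×-nonNeg n 0≤M) (×-nonNeg m 0≤M))

theorem3 : ∃ λ (C : ℕ) →
    ∀ (n m : ℕ) → 2 ℕ.≤ m → m ℕ.≤ n →
    (c : Subset n → ℚ) → (∀ X → 0ℚ ≤ c X) → Monotone c → Subadditive c →
    (p : Fin n → ℚ) → (∀ j → 0ℚ ≤ p j) →
    (order : List (Fin n)) → order ↭ allFin n →
    (L : Fin m → ℚ) → GreedyRun c p order (λ _ → 0ℚ) L →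
    (f : Fin n → Fin m) →
    maxOf L ≤ ((+ C) / 1) * ratio n m * partitionMakespan c p f
theorem3 = 2 , λ where
  n (suc k) _ m≤n c 0≤c mono _ p 0≤p order order↭J L run f →
    greedyRun-makespan 0≤c mono 0≤p m≤n order↭J run f
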